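{- Let $n\ge 4$ and let $G$ be a graph with $n(C_3)$ triangles and, for each $i$, $g_i$ vertices of degree $i$. If $i(G,x)=i(C_n,x)$, then (i) $\sum_{i=0}^{n-1} g_i=n$; (ii) $\sum_{i=1}^{n-1} i\, g_i=2n$; (iii) $\sum_{i=2}^{n-1}\binom{i}{2} g_i=n+n(C_3)$; (iv) $n(C_3)\ge g_0+\sum_{i=3}^{n-1} g_i$, that is, there are at most $n(C_3)$ vertices of $G$ whose degree is not one or two.
   Context: All graphs are finite, undirected and simple. The independence polynomial of a graph $G$ is $i(G,x)=\sum_{k\ge 0} i_k x^k$, where $i_k$ is the number of independent sets (vertex sets inducing no edges) of size $k$ in $G$. $C_n$ denotes the cycle on $n$ vertices. -}

module Defs where

open import Data.Nat using (ℕ; zero; suc; _+_; _*_; _∸_; _≡ᵇ_; _<ᵇ_)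
open import Data.Bool using (Bool; true; false; _∧_; _∨_; not; if_then_else_)
open import Data.Fin using (Fin; toℕ)
open import Data.List using (List; []; _∷_; map; upTo; allFin; length; filter; _++_)
open import Data.Bool.ListAction using (all)
open import Data.Nat.ListAction using (sum)
open import Data.Vec using (Vec; []; _∷_; lookup)
open import Relation.Binary.PropositionalEquality using (_≡_)
open import Relation.Nullary using (¬_)
open import Data.Bool using (T)
open import Relation.Nullary.Decidable using (does)
import Data.Fin as Fin

Adj : ℕ → Set
Adj m = Fin m → Fin m → Bool

record IsSimpleGraph {m : ℕ} (adj : Adj m) : Set where
  field
    sym   : ∀ i j → adj i j ≡ adj j i
    irrefl : ∀ i → adj i i ≡ false

countB : {A : Set} → (A → Bool) → List A → ℕ
countB p xs = length (filter (λ x → Data.Bool.T? (p x)) xs)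

-- all vertex subsets of Fin m (as characteristic vectors)
allSubsets : (m : ℕ) → List (Vec Bool m)
allSubsets zero = [] ∷ []
allSubsets (suc m) = map (true ∷_) (allSubsets m) ++ map (false ∷_) (allSubsets m)

size : {m : ℕ} → Vec Bool m → ℕ
size [] = 0
size (true ∷ s) = suc (size s)
size (false ∷ s) = size s

_<F_ : {m : ℕ} → Fin m → Fin m → Bool
i <F j = toℕ i <ᵇ toℕ j

independent : {m : ℕ} → Adj m → Vec Bool m → Bool
independent {m} adj s =
  all (λ i → all (λ j → not (i <F j ∧ lookup s i ∧ lookup s j ∧ adj i j)) (allFin m)) (allFin m)

indepCoeff : {m : ℕ} → Adj m → ℕ → ℕ
indepCoeff {m} adj k = countB (λ s → (size s ≡ᵇ k) ∧ independent adj s) (allSubsets m)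

SameIndepPoly : {m n : ℕ} → Adj m → Adj n → Set
SameIndepPoly g h = ∀ k → indepCoeff g k ≡ indepCoeff h k

cycleSucc : (n : ℕ) → Fin n → Fin n → Bool
cycleSucc n i j = (suc (toℕ i) ≡ᵇ toℕ j) ∨ ((suc (toℕ i) ≡ᵇ n) ∧ (toℕ j ≡ᵇ 0))

cycleAdj : (n : ℕ) → Adj n
cycleAdj n i j = cycleSucc n i j ∨ cycleSucc n j i

degree : {m : ℕ} → Adj m → Fin m → ℕ
degree {m} adj v = countB (λ u → not (toℕ u ≡ᵇ toℕ v) ∧ adj v u) (allFin m)

degCount : {m : ℕ} → Adj m → ℕ → ℕ
degCount {m} adj i = countB (λ v → degree adj v ≡ᵇ i) (allFin m)

isTriangle : {m : ℕ} → Adj m → Vec Bool m → Bool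
isTriangle {m} adj s =
  (size s ≡ᵇ 3) ∧
  all (λ i → all (λ j → not (i <F j ∧ lookup s i ∧ lookup s j) ∨ adj i j) (allFin m)) (allFin m)

triangles : {m : ℕ} → Adj m → ℕ
triangles {m} adj = countB (isTriangle adj) (allSubsets m)

-- Σ_{i=lo}^{hi-1} f i
sumRange : ℕ → ℕ → (ℕ → ℕ) → ℕ
sumRange lo hi f = sum (map (λ k → f (lo + k)) (upTo (hi ∸ lo)))

-- Compare the first coefficients of i(G,x) and i(Cₙ,x). As i₁ counts vertices and
-- i₂ = C(n,2) − |E|, the graph G has n vertices and n edges, so its degrees sum to 2n.
-- Inclusion–exclusion over the vertex triples gives i₃ = C(n,3) − (n − 2)|E| + P − n(C₃),
-- where P = Σ_v C(deg v, 2) counts the paths of length two by their middle vertex. Since Cₙ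
-- (n ≥ 4) is 2-regular and triangle-free, P(Cₙ) = n, hence P(G) = n + n(C₃). Finally
-- C(d,2) − d + 1 is 0 for d ∈ {1,2} and at least 1 otherwise, and its sum over the vertices
-- of G is (n + n(C₃)) − 2n + n = n(C₃).
module Submission where

open import Defs
open import Data.Nat using (ℕ; zero; suc; _+_; _*_; _∸_; _≡ᵇ_; _≤_; _<_; _≥_; z≤n; s≤s)
open import Data.Nat.Properties
open import Data.Nat.Combinatorics using (_C_; nC1≡n; nCk+nC[k+1]≡[n+1]C[k+1])
open import Data.Nat.Solver using (module +-*-Solver)
open import Algebra.Properties.CommutativeSemigroup +-commutativeSemigroup using (interchange)
open import Data.Bool using (Bool; true; false; _∧_; _∨_; not; T; T?)
open import Data.Empty using (⊥; ⊥-elim)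
open import Data.Unit using (tt)
open import Data.Product using (_×_; _,_)
open import Data.Sum using (_⊎_; inj₁; inj₂)
open import Function.Bundles using (Equivalence)
open import Relation.Nullary using (¬_)
open import Data.Bool.Properties
  using ( ∧-commutativeMonoid; ∨-∧-booleanAlgebra; ∨-distribˡ-∧; ∧-assoc; ∧-identityʳ; ∧-zeroʳ
        ; ∨-zeroʳ; ∨-identityʳ; ∨-comm; T-∧; T-∨)
open import Algebra.Lattice.Properties.BooleanAlgebra ∨-∧-booleanAlgebra using (deMorgan₁)
open import Data.Fin using (Fin; toℕ; zero; suc)
open import Data.Fin.Properties using (toℕ<n; toℕ-injective)
open import Data.List using (List; []; _∷_; map; _++_; tabulate; allFin; applyUpTo; filter; length)
open import Data.List.Properties using (filter-++; length-++)
open import Data.Bool.ListAction using (all)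
open import Data.Vec using (Vec; []; _∷_; lookup)
open import Data.Vec.Functional using (tail)
import Data.Nat.ListAction as List
open import Algebra.Properties.Semiring.Sum +-*-semiring
  using (sum; sum-syntax; sum-cong-≗; ∑-distrib-+; *-distribˡ-sum; ∑-comm)
import Algebra.Properties.CommutativeMonoid.Sum ∧-commutativeMonoid as Conj
open import Algebra.Solver.CommutativeMonoid ∧-commutativeMonoid using (_⊕_; _⊜_) renaming (solve to ∧-solve)
open import Relation.Binary.PropositionalEquality
  using (_≡_; _≢_; refl; sym; trans; cong; cong₂; subst; subst₂; module ≡-Reasoning)

open ≡-Reasoning
open +-*-Solver using (solve; _:+_; _:*_; _:=_; con)

⟦_⟧ : Bool → ℕ
⟦ true ⟧ = 1
⟦ false ⟧ = 0

⟦⟧≤1 : ∀ b → ⟦ b ⟧ ≤ 1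
⟦⟧≤1 false = z≤n
⟦⟧≤1 true = s≤s z≤n

⟦∧⟧ : ∀ a b → ⟦ a ∧ b ⟧ ≡ ⟦ a ⟧ * ⟦ b ⟧
⟦∧⟧ false b = refl
⟦∧⟧ true b = sym (+-identityʳ ⟦ b ⟧)

⟦⟧≡0 : ∀ {x} → ¬ T x → ⟦ x ⟧ ≡ 0
⟦⟧≡0 {false} _ = refl
⟦⟧≡0 {true} ¬x = ⊥-elim (¬x tt)

⟦∨⟧-disjoint : ∀ x y → ¬ (T x × T y) → ⟦ x ∨ y ⟧ ≡ ⟦ x ⟧ + ⟦ y ⟧
⟦∨⟧-disjoint false y _ = refl
⟦∨⟧-disjoint true false _ = refl
⟦∨⟧-disjoint true true ¬both = ⊥-elim (¬both (tt , tt))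

sum-const : ∀ m c → ∑[ i < m ] c ≡ m * c
sum-const zero c = refl
sum-const (suc m) c = cong (c +_) (sum-const m c)

⟦⟧*sum≡sum⟦∧⟧ : ∀ {m} b (g : Fin m → Bool) → ⟦ b ⟧ * ∑[ i < m ] ⟦ g i ⟧ ≡ ∑[ i < m ] ⟦ b ∧ g i ⟧
⟦⟧*sum≡sum⟦∧⟧ {m} b g = trans (*-distribˡ-sum {m} ⟦ b ⟧ _) (sum-cong-≗ {m} λ i → sym (⟦∧⟧ b (g i)))

sum-mono-≤ : ∀ {m} {f g : Fin m → ℕ} → (∀ i → f i ≤ g i) → sum f ≤ sum g
sum-mono-≤ {zero} f≤g = z≤n
sum-mono-≤ {suc m} f≤g = +-mono-≤ (f≤g zero) (sum-mono-≤ (λ i → f≤g (suc i)))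

sum-indicator-≤ : ∀ {m} (p : Fin m → Bool) → ∑[ i < m ] ⟦ p i ⟧ ≤ m
sum-indicator-≤ {m} p =
  subst (sum (λ i → ⟦ p i ⟧) ≤_) (trans (sum-const m 1) (*-identityʳ m)) (sum-mono-≤ (λ i → ⟦⟧≤1 (p i)))

sum-indicator-< : ∀ {m} (p : Fin m → Bool) v → p v ≡ false → ∑[ i < m ] ⟦ p i ⟧ < m
sum-indicator-< {suc m} p zero pv≡false rewrite pv≡false = s≤s (sum-indicator-≤ (tail p))
sum-indicator-< {suc m} p (suc v) pv≡false =
  subst (_≤ suc m) (+-suc ⟦ p zero ⟧ _) (+-mono-≤ (⟦⟧≤1 (p zero)) (sum-indicator-< (tail p) v pv≡false))

sum-pick : ∀ {m} (f : ℕ → ℕ) c → c < m → ∑[ i < m ] (f (toℕ i) * ⟦ c ≡ᵇ toℕ i ⟧) ≡ f c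
sum-pick {suc m} f zero _ =
  trans (cong₂ _+_ (*-identityʳ (f 0)) rest≡0) (+-identityʳ (f 0))
  where
  rest≡0 : ∑[ i < m ] (f (suc (toℕ i)) * 0) ≡ 0
  rest≡0 = trans (sum-cong-≗ {m} λ i → *-zeroʳ (f (suc (toℕ i)))) (trans (sum-const m 0) (*-zeroʳ m))
sum-pick {suc m} f (suc c) (s≤s c<m) =
  trans (cong (_+ ∑[ i < m ] (f (suc (toℕ i)) * ⟦ c ≡ᵇ toℕ i ⟧)) (*-zeroʳ (f 0))) (sum-pick (λ i → f (suc i)) c c<m)

sum-≡ᵇ : ∀ {m} c → c < m → ∑[ i < m ] ⟦ c ≡ᵇ toℕ i ⟧ ≡ 1
sum-≡ᵇ {m} c c<m = trans (sum-cong-≗ {m} λ i → sym (*-identityˡ ⟦ c ≡ᵇ toℕ i ⟧)) (sum-pick (λ _ → 1) c c<m)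

countB-∷ : ∀ {A : Set} (p : A → Bool) x xs → countB p (x ∷ xs) ≡ ⟦ p x ⟧ + countB p xs
countB-∷ p x xs with p x
... | true = refl
... | false = refl

countB-cong : ∀ {A : Set} {p q : A → Bool} → (∀ x → p x ≡ q x) → ∀ xs → countB p xs ≡ countB q xs
countB-cong p≗q [] = refl
countB-cong {p = p} {q} p≗q (x ∷ xs) = begin
  countB p (x ∷ xs)       ≡⟨ countB-∷ p x xs ⟩
  ⟦ p x ⟧ + countB p xs   ≡⟨ cong₂ _+_ (cong ⟦_⟧ (p≗q x)) (countB-cong p≗q xs) ⟩
  ⟦ q x ⟧ + countB q xs   ≡⟨ countB-∷ q x xs ⟨
  countB q (x ∷ xs)       ∎

countB-++ : ∀ {A : Set} (p : A → Bool) xs ys → countB p (xs ++ ys) ≡ countB p xs + countB p ys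
countB-++ p xs ys =
  trans (cong length (filter-++ (λ x → T? (p x)) xs ys)) (length-++ (filter (λ x → T? (p x)) xs))

countB-map : ∀ {A B : Set} (p : B → Bool) (f : A → B) xs → countB p (map f xs) ≡ countB (λ x → p (f x)) xs
countB-map p f [] = refl
countB-map p f (x ∷ xs) = trans (countB-∷ p (f x) (map f xs))
  (trans (cong (⟦ p (f x) ⟧ +_) (countB-map p f xs)) (sym (countB-∷ (λ x → p (f x)) x xs)))

countB-false : ∀ {A : Set} (xs : List A) → countB (λ _ → false) xs ≡ 0
countB-false [] = refl
countB-false (x ∷ xs) = countB-false xs

countB-const-∧ : ∀ {A : Set} b (p : A → Bool) xs → countB (λ x → b ∧ p x) xs ≡ ⟦ b ⟧ * countB p xs
countB-const-∧ false p xs = countB-false xs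
countB-const-∧ true p xs = sym (+-identityʳ _)

countB-tabulate : ∀ {m} {A : Set} (p : A → Bool) (f : Fin m → A) → countB p (tabulate f) ≡ ∑[ i < m ] ⟦ p (f i) ⟧
countB-tabulate {zero} p f = refl
countB-tabulate {suc m} p f = trans (countB-∷ p (f zero) _) (cong (⟦ p (f zero) ⟧ +_) (countB-tabulate p (λ i → f (suc i))))

countB-allFin : ∀ {m} (p : Fin m → Bool) → countB p (allFin m) ≡ ∑[ i < m ] ⟦ p i ⟧
countB-allFin p = countB-tabulate p (λ i → i)

⋀ : ∀ {m} → (Fin m → Bool) → Bool
⋀ = Conj.sum

all-tabulate : ∀ {m} {A : Set} (p : A → Bool) (f : Fin m → A) → all p (tabulate f) ≡ ⋀ (λ i → p (f i))
all-tabulate {zero} p f = refl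
all-tabulate {suc m} p f = cong (p (f zero) ∧_) (all-tabulate p (λ i → f (suc i)))

all-allFin : ∀ {m} (p : Fin m → Bool) → all p (allFin m) ≡ ⋀ p
all-allFin p = all-tabulate p (λ i → i)

∑₂ : ∀ {m} → (Fin m → Fin m → ℕ) → ℕ
∑₂ {zero} f = 0
∑₂ {suc m} f = ∑[ k < m ] f zero (suc k) + ∑₂ (λ j k → f (suc j) (suc k))

∑₃ : ∀ {m} → (Fin m → Fin m → Fin m → ℕ) → ℕ
∑₃ {zero} f = 0
∑₃ {suc m} f = ∑₂ (λ j k → f zero (suc j) (suc k)) + ∑₃ (λ i j k → f (suc i) (suc j) (suc k))

∑₂-cong : ∀ {m} {f g : Fin m → Fin m → ℕ} → (∀ i j → f i j ≡ g i j) → ∑₂ f ≡ ∑₂ g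
∑₂-cong {zero} f≗g = refl
∑₂-cong {suc m} f≗g = cong₂ _+_ (sum-cong-≗ (λ k → f≗g zero (suc k))) (∑₂-cong (λ i j → f≗g (suc i) (suc j)))

∑₃-cong : ∀ {m} {f g : Fin m → Fin m → Fin m → ℕ} → (∀ i j k → f i j k ≡ g i j k) → ∑₃ f ≡ ∑₃ g
∑₃-cong {zero} f≗g = refl
∑₃-cong {suc m} f≗g =
  cong₂ _+_ (∑₂-cong (λ j k → f≗g zero (suc j) (suc k))) (∑₃-cong (λ i j k → f≗g (suc i) (suc j) (suc k)))

∑₂-distrib-+ : ∀ {m} (f g : Fin m → Fin m → ℕ) → ∑₂ (λ i j → f i j + g i j) ≡ ∑₂ f + ∑₂ g
∑₂-distrib-+ {zero} f g = refl
∑₂-distrib-+ {suc m} f g = begin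
  ∑[ k < m ] (f zero (suc k) + g zero (suc k)) + ∑₂ (λ i j → f (suc i) (suc j) + g (suc i) (suc j))
    ≡⟨ cong₂ _+_ (∑-distrib-+ (λ k → f zero (suc k)) _) (∑₂-distrib-+ (λ i j → f (suc i) (suc j)) _) ⟩
  (F₀ + G₀) + (F′ + G′)
    ≡⟨ interchange F₀ G₀ F′ G′ ⟩
  (F₀ + F′) + (G₀ + G′) ∎
  where
  F₀ = ∑[ k < m ] f zero (suc k)
  G₀ = ∑[ k < m ] g zero (suc k)
  F′ = ∑₂ λ i j → f (suc i) (suc j)
  G′ = ∑₂ λ i j → g (suc i) (suc j)

∑₃-distrib-+ : ∀ {m} (f g : Fin m → Fin m → Fin m → ℕ) → ∑₃ (λ i j k → f i j k + g i j k) ≡ ∑₃ f + ∑₃ g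
∑₃-distrib-+ {zero} f g = refl
∑₃-distrib-+ {suc m} f g =
  trans (cong₂ _+_ (∑₂-distrib-+ (λ j k → f zero (suc j) (suc k)) _)
                   (∑₃-distrib-+ (λ i j k → f (suc i) (suc j) (suc k)) _))
        (interchange (∑₂ λ j k → f zero (suc j) (suc k)) (∑₂ λ j k → g zero (suc j) (suc k))
                     (∑₃ λ i j k → f (suc i) (suc j) (suc k)) (∑₃ λ i j k → g (suc i) (suc j) (suc k)))

*-distribˡ-∑₂ : ∀ {m} c (f : Fin m → Fin m → ℕ) → c * ∑₂ f ≡ ∑₂ (λ i j → c * f i j)
*-distribˡ-∑₂ {zero} c f = *-zeroʳ c
*-distribˡ-∑₂ {suc m} c f = trans (*-distribˡ-+ c _ _)
  (cong₂ _+_ (*-distribˡ-sum c (λ k → f zero (suc k))) (*-distribˡ-∑₂ c (λ j k → f (suc j) (suc k))))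

∑₂-endpoints : ∀ {m} (g : Fin m → ℕ) → ∑₂ (λ j k → g j + g k) + sum g ≡ m * sum g
∑₂-endpoints {zero} g = refl
∑₂-endpoints {suc m} g = begin
  ∑[ k < m ] (g zero + g (suc k)) + P + (g zero + G)
    ≡⟨ cong (λ x → x + P + (g zero + G))
            (trans (∑-distrib-+ (λ _ → g zero) (λ k → g (suc k))) (cong (_+ G) (sum-const m (g zero)))) ⟩
  m * g zero + G + P + (g zero + G)
    ≡⟨ solve 4 (λ mg₀ G P g₀ → mg₀ :+ G :+ P :+ (g₀ :+ G) := (P :+ G) :+ (mg₀ :+ G :+ g₀))
               refl (m * g zero) G P (g zero) ⟩
  (P + G) + (m * g zero + G + g zero)
    ≡⟨ cong (_+ (m * g zero + G + g zero)) (∑₂-endpoints (λ k → g (suc k))) ⟩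
  m * G + (m * g zero + G + g zero)
    ≡⟨ solve 3 (λ m G g₀ → m :* G :+ (m :* g₀ :+ G :+ g₀) := (g₀ :+ G) :+ m :* (g₀ :+ G)) refl m G (g zero) ⟩
  suc m * (g zero + G) ∎
  where
  G = ∑[ k < m ] g (suc k)
  P = ∑₂ λ j k → g (suc j) + g (suc k)

∑₂-vanishing : ∀ {m} (f : Fin m → Fin m → ℕ) → (∀ i j → toℕ i < toℕ j → f i j ≡ 0) → ∑₂ f ≡ 0
∑₂-vanishing {zero} f f≡0 = refl
∑₂-vanishing {suc m} f f≡0 =
  cong₂ _+_ (trans (sum-cong-≗ λ k → f≡0 zero (suc k) (s≤s z≤n)) (trans (sum-const m 0) (*-zeroʳ m)))
            (∑₂-vanishing (λ i j → f (suc i) (suc j)) (λ i j i<j → f≡0 (suc i) (suc j) (s≤s i<j)))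

∑₃-vanishing : ∀ {m} (f : Fin m → Fin m → Fin m → ℕ) →
  (∀ i j k → toℕ i < toℕ j → toℕ j < toℕ k → f i j k ≡ 0) → ∑₃ f ≡ 0
∑₃-vanishing {zero} f f≡0 = refl
∑₃-vanishing {suc m} f f≡0 =
  cong₂ _+_ (∑₂-vanishing (λ j k → f zero (suc j) (suc k)) (λ j k j<k → f≡0 zero (suc j) (suc k) (s≤s z≤n) (s≤s j<k)))
            (∑₃-vanishing (λ i j k → f (suc i) (suc j) (suc k))
                          (λ i j k i<j j<k → f≡0 (suc i) (suc j) (suc k) (s≤s i<j) (s≤s j<k)))

tailAdj : ∀ {m} → Adj (suc m) → Adj m
tailAdj a i j = a (suc i) (suc j)

_⊆ᵇ_ : ∀ {m} → Vec Bool m → (Fin m → Bool) → Bool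
s ⊆ᵇ u = ⋀ λ j → not (lookup s j) ∨ u j

isClique : ∀ {m} → Adj m → Vec Bool m → Bool
isClique a s = ⋀ λ i → ⋀ λ j → not (i <F j ∧ lookup s i ∧ lookup s j) ∨ a i j

-- Independent sets are the cliques of ∁ a and triangles the 3-cliques of a; restricting to
-- the vertex set u makes the count recursive in the first vertex (cliques-suc).
cliques : ∀ {m} → ℕ → Adj m → (Fin m → Bool) → ℕ
cliques {m} k a u = countB (λ s → (size s ≡ᵇ k) ∧ (isClique a s ∧ s ⊆ᵇ u)) (allSubsets m)

⊆ᵇ-∧ : ∀ {m} (u v : Fin m → Bool) s → s ⊆ᵇ (λ j → u j ∧ v j) ≡ s ⊆ᵇ u ∧ s ⊆ᵇ v
⊆ᵇ-∧ {m} u v s = trans (Conj.sum-cong-≗ λ j → ∨-distribˡ-∧ (not (lookup s j)) (u j) (v j)) (Conj.∑-distrib-+ {m} _ _)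

isClique-false∷ : ∀ {m} (a : Adj (suc m)) s → isClique a (false ∷ s) ≡ isClique (tailAdj a) s
isClique-false∷ {m} a s = cong (_∧ isClique (tailAdj a) s) (Conj.sum-replicate-zero m)

countB-allSubsets-suc : ∀ {m} (p : Vec Bool (suc m) → Bool) →
  countB p (allSubsets (suc m)) ≡ countB (λ s → p (true ∷ s)) (allSubsets m) + countB (λ s → p (false ∷ s)) (allSubsets m)
countB-allSubsets-suc {m} p = trans (countB-++ p (map (true ∷_) (allSubsets m)) _)
  (cong₂ _+_ (countB-map p _ (allSubsets m)) (countB-map p _ (allSubsets m)))

cliques-suc : ∀ {m} k (a : Adj (suc m)) (u : Fin (suc m) → Bool) →
  cliques (suc k) a u ≡ ⟦ u zero ⟧ * cliques k (tailAdj a) (λ j → tail u j ∧ tail (a zero) j)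
                       + cliques (suc k) (tailAdj a) (tail u)
cliques-suc {m} k a u = trans (countB-allSubsets-suc {m} _) (cong₂ _+_ with-first without-first)
  where
  shuffle : ∀ z A P u₀ S → z ∧ ((A ∧ P) ∧ (u₀ ∧ S)) ≡ u₀ ∧ (z ∧ (P ∧ (S ∧ A)))
  shuffle = ∧-solve 5 (λ z A P u₀ S → z ⊕ ((A ⊕ P) ⊕ (u₀ ⊕ S)) ⊜ u₀ ⊕ (z ⊕ (P ⊕ (S ⊕ A)))) refl
  with-first = trans
    (countB-cong (λ s → trans (shuffle (size s ≡ᵇ k) (s ⊆ᵇ tail (a zero)) (isClique (tailAdj a) s) (u zero) (s ⊆ᵇ tail u))
        (cong (λ z → u zero ∧ ((size s ≡ᵇ k) ∧ (isClique (tailAdj a) s ∧ z))) (sym (⊆ᵇ-∧ (tail u) (tail (a zero)) s))))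
      (allSubsets m))
    (countB-const-∧ (u zero) _ (allSubsets m))
  without-first =
    countB-cong (λ s → cong (λ z → (size s ≡ᵇ suc k) ∧ (z ∧ s ⊆ᵇ tail u)) (isClique-false∷ a s)) (allSubsets m)

cliques-0 : ∀ {m} (a : Adj m) u → cliques 0 a u ≡ 1
cliques-0 {zero} a u = refl
cliques-0 {suc m} a u = trans (countB-allSubsets-suc {m} _)
  (trans (cong₂ _+_ (countB-false (allSubsets m))
                    (countB-cong (λ s → cong (λ z → (size s ≡ᵇ 0) ∧ (z ∧ s ⊆ᵇ tail u)) (isClique-false∷ a s))
                                 (allSubsets m)))
         (cliques-0 (tailAdj a) (tail u)))

cliques-1 : ∀ {m} (a : Adj m) u → cliques 1 a u ≡ ∑[ i < m ] ⟦ u i ⟧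
cliques-1 {zero} a u = refl
cliques-1 {suc m} a u = trans (cliques-suc 0 a u)
  (cong₂ _+_ (trans (cong (⟦ u zero ⟧ *_) (cliques-0 {m} _ _)) (*-identityʳ _)) (cliques-1 (tailAdj a) (tail u)))

cliques-2 : ∀ {m} (a : Adj m) u → cliques 2 a u ≡ ∑₂ (λ i j → ⟦ u i ∧ u j ∧ a i j ⟧)
cliques-2 {zero} a u = refl
cliques-2 {suc m} a u = trans (cliques-suc 1 a u) (cong₂ _+_ first (cliques-2 (tailAdj a) (tail u)))
  where
  first : ⟦ u zero ⟧ * cliques 1 (tailAdj a) (λ j → tail u j ∧ tail (a zero) j)
        ≡ ∑[ k < m ] ⟦ u zero ∧ u (suc k) ∧ a zero (suc k) ⟧
  first = trans (cong (⟦ u zero ⟧ *_) (cliques-1 (tailAdj a) _))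
    (⟦⟧*sum≡sum⟦∧⟧ (u zero) (λ k → tail u k ∧ tail (a zero) k))

cliques-3 : ∀ {m} (a : Adj m) u → cliques 3 a u ≡ ∑₃ (λ i j k → ⟦ u i ∧ u j ∧ u k ∧ a i j ∧ a i k ∧ a j k ⟧)
cliques-3 {zero} a u = refl
cliques-3 {suc m} a u = trans (cliques-suc 2 a u) (cong₂ _+_ first (cliques-3 (tailAdj a) (tail u)))
  where
  shuffle : ∀ x y z p q r → x ∧ ((y ∧ p) ∧ (z ∧ q) ∧ r) ≡ x ∧ y ∧ z ∧ p ∧ q ∧ r
  shuffle = ∧-solve 6 (λ x y z p q r → x ⊕ ((y ⊕ p) ⊕ ((z ⊕ q) ⊕ r)) ⊜ x ⊕ (y ⊕ (z ⊕ (p ⊕ (q ⊕ r))))) refl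
  first : ⟦ u zero ⟧ * cliques 2 (tailAdj a) (λ j → tail u j ∧ tail (a zero) j)
        ≡ ∑₂ (λ j k → ⟦ u zero ∧ u (suc j) ∧ u (suc k) ∧ a zero (suc j) ∧ a zero (suc k) ∧ a (suc j) (suc k) ⟧)
  first = trans (cong (⟦ u zero ⟧ *_) (cliques-2 (tailAdj a) _))
    (trans (*-distribˡ-∑₂ {m} ⟦ u zero ⟧ _) (∑₂-cong {m} λ j k → trans (sym (⟦∧⟧ (u zero) _))
      (cong ⟦_⟧ (shuffle (u zero) (u (suc j)) (u (suc k)) (a zero (suc j)) (a zero (suc k)) (a (suc j) (suc k))))))

∁ : ∀ {m} → Adj m → Adj m
∁ a i j = not (a i j)

all²-allFin : ∀ {m} (f : Fin m → Fin m → Bool) → all (λ i → all (f i) (allFin m)) (allFin m) ≡ ⋀ λ i → ⋀ (f i)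
all²-allFin {m} f = trans (all-allFin (λ i → all (f i) (allFin m))) (Conj.sum-cong-≗ {m} λ i → all-allFin (f i))

⊆ᵇ-everything : ∀ {m} (s : Vec Bool m) → s ⊆ᵇ (λ _ → true) ≡ true
⊆ᵇ-everything {m} s = trans (Conj.sum-cong-≗ {m} λ j → ∨-zeroʳ (not (lookup s j))) (Conj.sum-replicate-zero m)

independent≡isClique∁ : ∀ {m} (a : Adj m) s → independent a s ≡ isClique (∁ a) s
independent≡isClique∁ {m} a s =
  trans (all²-allFin (λ i j → not (i <F j ∧ lookup s i ∧ lookup s j ∧ a i j))) (Conj.sum-cong-≗ {m} λ i → Conj.sum-cong-≗ {m} λ j →
  trans (cong not (reassoc (i <F j) (lookup s i) (lookup s j) (a i j))) (deMorgan₁ (i <F j ∧ lookup s i ∧ lookup s j) (a i j)))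
  where
  reassoc : ∀ x y z w → x ∧ y ∧ z ∧ w ≡ (x ∧ y ∧ z) ∧ w
  reassoc x y z w = trans (cong (x ∧_) (sym (∧-assoc y z w))) (sym (∧-assoc x (y ∧ z) w))

indepCoeff≡cliques : ∀ {m} (a : Adj m) k → indepCoeff a k ≡ cliques k (∁ a) (λ _ → true)
indepCoeff≡cliques {m} a k = countB-cong (λ s → cong ((size s ≡ᵇ k) ∧_)
  (trans (independent≡isClique∁ a s) (sym (trans (cong (isClique (∁ a) s ∧_) (⊆ᵇ-everything s)) (∧-identityʳ _)))))
  (allSubsets m)

triangles≡cliques : ∀ {m} (a : Adj m) → triangles a ≡ cliques 3 a (λ _ → true)
triangles≡cliques {m} a = countB-cong (λ s → cong ((size s ≡ᵇ 3) ∧_)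
  (trans (all²-allFin (λ i j → not (i <F j ∧ lookup s i ∧ lookup s j) ∨ a i j))
         (sym (trans (cong (isClique a s ∧_) (⊆ᵇ-everything s)) (∧-identityʳ _)))))
  (allSubsets m)

deg : ∀ {m} → Adj m → Fin m → ℕ
deg {m} a v = ∑[ u < m ] ⟦ a v u ⟧

edges : ∀ {m} → Adj m → ℕ
edges a = ∑₂ λ i j → ⟦ a i j ⟧

∑-triples : ∀ {m} → (Bool → Bool → Bool → ℕ) → Adj m → ℕ
∑-triples f a = ∑₃ λ i j k → f (a i j) (a i k) (a j k)

edgeCount cherryCount noEdge allEdges : Bool → Bool → Bool → ℕ
edgeCount x y z = ⟦ x ⟧ + ⟦ y ⟧ + ⟦ z ⟧
cherryCount x y z = ⟦ x ∧ y ⟧ + ⟦ x ∧ z ⟧ + ⟦ y ∧ z ⟧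
noEdge x y z = ⟦ not x ∧ not y ∧ not z ⟧
allEdges x y z = ⟦ x ∧ y ∧ z ⟧

indepCoeff-1 : ∀ {m} (a : Adj m) → indepCoeff a 1 ≡ m
indepCoeff-1 {m} a = trans (indepCoeff≡cliques a 1) (trans (cliques-1 (∁ a) _) (trans (sum-const m 1) (*-identityʳ m)))

indepCoeff-2 : ∀ {m} (a : Adj m) → indepCoeff a 2 ≡ edges (∁ a)
indepCoeff-2 a = trans (indepCoeff≡cliques a 2) (cliques-2 (∁ a) _)

indepCoeff-3 : ∀ {m} (a : Adj m) → indepCoeff a 3 ≡ ∑-triples noEdge a
indepCoeff-3 a = trans (indepCoeff≡cliques a 3) (cliques-3 (∁ a) _)

triangles≡∑-triples : ∀ {m} (a : Adj m) → triangles a ≡ ∑-triples allEdges a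
triangles≡∑-triples a = trans (triangles≡cliques a) (cliques-3 a _)

module _ {m} {a : Adj (suc m)} (simple : IsSimpleGraph a) where
  open IsSimpleGraph simple renaming (sym to adj-sym; irrefl to adj-irrefl)

  tailAdj-simple : IsSimpleGraph (tailAdj a)
  tailAdj-simple = record { sym = λ i j → adj-sym (suc i) (suc j) ; irrefl = λ i → adj-irrefl (suc i) }

  deg-zero : deg a zero ≡ ∑[ j < m ] ⟦ a zero (suc j) ⟧
  deg-zero = cong (λ b → ⟦ b ⟧ + ∑[ j < m ] ⟦ a zero (suc j) ⟧) (adj-irrefl zero)

  deg-suc : ∀ v → deg a (suc v) ≡ ⟦ a zero (suc v) ⟧ + deg (tailAdj a) v
  deg-suc v = cong (λ b → ⟦ b ⟧ + deg (tailAdj a) v) (adj-sym (suc v) zero)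

handshake : ∀ {m} (a : Adj m) → IsSimpleGraph a → ∑[ v < m ] deg a v ≡ edges a + edges a
handshake {zero} a simple = refl
handshake {suc m} a simple = begin
  deg a zero + ∑[ v < m ] deg a (suc v)
    ≡⟨ cong₂ _+_ (deg-zero simple)
                 (trans (sum-cong-≗ (deg-suc simple)) (∑-distrib-+ (λ v → ⟦ a zero (suc v) ⟧) (deg a′))) ⟩
  B + (B + ∑[ v < m ] deg a′ v)
    ≡⟨ cong (λ x → B + (B + x)) (handshake a′ (tailAdj-simple simple)) ⟩
  B + (B + (edges a′ + edges a′))
    ≡⟨ solve 2 (λ b e → b :+ (b :+ (e :+ e)) := (b :+ e) :+ (b :+ e)) refl B (edges a′) ⟩
  (B + edges a′) + (B + edges a′) ∎
  where
  a′ = tailAdj a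
  B = ∑[ v < m ] ⟦ a zero (suc v) ⟧

edges-in-triples : ∀ {m} (a : Adj m) → ∑-triples edgeCount a + (edges a + edges a) ≡ m * edges a
edges-in-triples {zero} a = refl
edges-in-triples {suc m} a = begin
  ∑₂ (λ j k → ⟦ b j ⟧ + ⟦ b k ⟧ + ⟦ a′ j k ⟧) + T′ + ((B + E′) + (B + E′))
    ≡⟨ cong (λ x → x + T′ + ((B + E′) + (B + E′))) (∑₂-distrib-+ (λ j k → ⟦ b j ⟧ + ⟦ b k ⟧) (λ j k → ⟦ a′ j k ⟧))
     ⟩
  (P + E′) + T′ + ((B + E′) + (B + E′))
    ≡⟨ solve 4 (λ P E′ T′ B → (P :+ E′) :+ T′ :+ ((B :+ E′) :+ (B :+ E′)) := (P :+ B) :+ (T′ :+ (E′ :+ E′)) :+ (B :+ E′))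
               refl P E′ T′ B ⟩
  (P + B) + (T′ + (E′ + E′)) + (B + E′)
    ≡⟨ cong₂ (λ x y → x + y + (B + E′)) (∑₂-endpoints (λ j → ⟦ b j ⟧)) (edges-in-triples a′) ⟩
  m * B + m * E′ + (B + E′)
    ≡⟨ solve 3 (λ m B E′ → m :* B :+ m :* E′ :+ (B :+ E′) := (B :+ E′) :+ m :* (B :+ E′)) refl m B E′ ⟩
  suc m * (B + E′) ∎
  where
  a′ = tailAdj a
  b = tail (a zero)
  B = ∑[ j < m ] ⟦ b j ⟧
  E′ = edges a′
  T′ = ∑-triples edgeCount a′
  P = ∑₂ λ j k → ⟦ b j ⟧ + ⟦ b k ⟧

[1+n]C2≡n+nC2 : ∀ n → suc n C 2 ≡ n + n C 2
[1+n]C2≡n+nC2 n = trans (sym (nCk+nC[k+1]≡[n+1]C[k+1] n 1)) (cong (_+ n C 2) (nC1≡n n))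

[⟦b⟧+n]C2 : ∀ b n → (⟦ b ⟧ + n) C 2 ≡ ⟦ b ⟧ * n + n C 2
[⟦b⟧+n]C2 false n = refl
[⟦b⟧+n]C2 true n = trans ([1+n]C2≡n+nC2 n) (cong (_+ n C 2) (sym (+-identityʳ n)))

∑₂-pairs-within : ∀ {m} (b : Fin m → Bool) → ∑₂ (λ j k → ⟦ b j ∧ b k ⟧) ≡ (∑[ j < m ] ⟦ b j ⟧) C 2
∑₂-pairs-within {zero} b = refl
∑₂-pairs-within {suc m} b = begin
  ∑[ k < m ] ⟦ b zero ∧ b (suc k) ⟧ + ∑₂ (λ j k → ⟦ b (suc j) ∧ b (suc k) ⟧)
    ≡⟨ cong₂ _+_ (sym (⟦⟧*sum≡sum⟦∧⟧ (b zero) (tail b)))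
                 (∑₂-pairs-within (tail b)) ⟩
  ⟦ b zero ⟧ * B + B C 2
    ≡⟨ [⟦b⟧+n]C2 (b zero) B ⟨
  (⟦ b zero ⟧ + B) C 2 ∎
  where B = ∑[ j < m ] ⟦ b (suc j) ⟧

⟦⟧*-⟦⟧+ : ∀ x y n → ⟦ x ⟧ * (⟦ y ⟧ + n) ≡ ⟦ x ∧ y ⟧ + ⟦ x ⟧ * n
⟦⟧*-⟦⟧+ false y n = refl
⟦⟧*-⟦⟧+ true y n = trans (+-identityʳ _) (cong (⟦ y ⟧ +_) (sym (+-identityʳ n)))

∑₂-edges-at : ∀ {m} (a : Adj m) → IsSimpleGraph a → (b : Fin m → Bool) →
  ∑₂ (λ j k → ⟦ b j ∧ a j k ⟧ + ⟦ b k ∧ a j k ⟧) ≡ ∑[ v < m ] (⟦ b v ⟧ * deg a v)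
∑₂-edges-at {zero} a simple b = refl
∑₂-edges-at {suc m} a simple b = begin
  ∑[ k < m ] (⟦ b zero ∧ a zero (suc k) ⟧ + ⟦ b (suc k) ∧ a zero (suc k) ⟧) + Z
    ≡⟨ cong (_+ Z) (∑-distrib-+ (λ k → ⟦ b zero ∧ a zero (suc k) ⟧) _) ⟩
  (X + Y) + Z
    ≡⟨ +-assoc X Y Z ⟩
  X + (Y + Z)
    ≡⟨ cong₂ _+_ (sym (⟦⟧*sum≡sum⟦∧⟧ (b zero) (tail (a zero))))
                 (cong (Y +_) (∑₂-edges-at (tailAdj a) (tailAdj-simple simple) (tail b))) ⟩
  ⟦ b zero ⟧ * ∑[ k < m ] ⟦ a zero (suc k) ⟧ + (Y + ∑[ v < m ] (⟦ b (suc v) ⟧ * deg (tailAdj a) v))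
    ≡⟨ cong₂ _+_ (cong (⟦ b zero ⟧ *_) (sym (deg-zero simple)))
                 (sym (∑-distrib-+ (λ v → ⟦ b (suc v) ∧ a zero (suc v) ⟧) _)) ⟩
  ⟦ b zero ⟧ * deg a zero + ∑[ v < m ] (⟦ b (suc v) ∧ a zero (suc v) ⟧ + ⟦ b (suc v) ⟧ * deg (tailAdj a) v)
    ≡⟨ cong (⟦ b zero ⟧ * deg a zero +_) (sum-cong-≗ λ v →
         trans (sym (⟦⟧*-⟦⟧+ (b (suc v)) (a zero (suc v)) _)) (cong (⟦ b (suc v) ⟧ *_) (sym (deg-suc simple v)))) ⟩
  ⟦ b zero ⟧ * deg a zero + ∑[ v < m ] (⟦ b (suc v) ⟧ * deg a (suc v)) ∎
  where
  X = ∑[ k < m ] ⟦ b zero ∧ a zero (suc k) ⟧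
  Y = ∑[ k < m ] ⟦ b (suc k) ∧ a zero (suc k) ⟧
  Z = ∑₂ λ j k → ⟦ b (suc j) ∧ a (suc j) (suc k) ⟧ + ⟦ b (suc k) ∧ a (suc j) (suc k) ⟧

cherries-in-triples : ∀ {m} (a : Adj m) → IsSimpleGraph a → ∑-triples cherryCount a ≡ ∑[ v < m ] (deg a v C 2)
cherries-in-triples {zero} a simple = refl
cherries-in-triples {suc m} a simple = begin
  ∑₂ (λ j k → ⟦ b j ∧ b k ⟧ + ⟦ b j ∧ a′ j k ⟧ + ⟦ b k ∧ a′ j k ⟧) + ∑-triples cherryCount a′
    ≡⟨ cong (_+ ∑-triples cherryCount a′)
            (trans (∑₂-cong λ j k → +-assoc ⟦ b j ∧ b k ⟧ _ _) (∑₂-distrib-+ (λ j k → ⟦ b j ∧ b k ⟧) _)) ⟩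
  ∑₂ (λ j k → ⟦ b j ∧ b k ⟧) + ∑₂ (λ j k → ⟦ b j ∧ a′ j k ⟧ + ⟦ b k ∧ a′ j k ⟧) + ∑-triples cherryCount a′
    ≡⟨ cong₂ (λ x y → x + y + ∑-triples cherryCount a′) (∑₂-pairs-within b) (∑₂-edges-at a′ simple′ b) ⟩
  B C 2 + ∑[ v < m ] (⟦ b v ⟧ * deg a′ v) + ∑-triples cherryCount a′
    ≡⟨ trans (+-assoc (B C 2) _ _)
             (cong (λ x → B C 2 + (∑[ v < m ] (⟦ b v ⟧ * deg a′ v) + x)) (cherries-in-triples a′ simple′)) ⟩
  B C 2 + (∑[ v < m ] (⟦ b v ⟧ * deg a′ v) + ∑[ v < m ] (deg a′ v C 2))
    ≡⟨ cong₂ _+_ (cong (_C 2) (sym (deg-zero simple))) (sym (∑-distrib-+ (λ v → ⟦ b v ⟧ * deg a′ v) _)) ⟩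
  deg a zero C 2 + ∑[ v < m ] (⟦ b v ⟧ * deg a′ v + deg a′ v C 2)
    ≡⟨ cong (deg a zero C 2 +_)
            (sum-cong-≗ λ v → trans (sym ([⟦b⟧+n]C2 (b v) (deg a′ v))) (cong (_C 2) (sym (deg-suc simple v)))) ⟩
  deg a zero C 2 + ∑[ v < m ] (deg a (suc v) C 2) ∎
  where
  a′ = tailAdj a
  simple′ = tailAdj-simple simple
  b = tail (a zero)
  B = ∑[ j < m ] ⟦ b j ⟧

edges-∁ : ∀ {m} (a : Adj m) → edges (∁ a) + edges a ≡ ∑₂ {m} (λ _ _ → 1)
edges-∁ {m} a = trans (sym (∑₂-distrib-+ {m} _ _)) (∑₂-cong {m} λ i j → complementary (a i j))
  where
  complementary : ∀ x → ⟦ not x ⟧ + ⟦ x ⟧ ≡ 1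
  complementary false = refl
  complementary true = refl

inclusion-exclusion₃ : ∀ {m} (a : Adj m) →
  ∑-triples noEdge a + ∑-triples edgeCount a + ∑-triples allEdges a ≡ ∑₃ {m} (λ _ _ _ → 1) + ∑-triples cherryCount a
inclusion-exclusion₃ {m} a = begin
  ∑-triples noEdge a + ∑-triples edgeCount a + ∑-triples allEdges a
    ≡⟨ cong (_+ ∑-triples allEdges a) (∑₃-distrib-+ {m} _ _) ⟨
  ∑₃ (λ i j k → noEdge (a i j) (a i k) (a j k) + edgeCount (a i j) (a i k) (a j k)) + ∑-triples allEdges a
    ≡⟨ ∑₃-distrib-+ {m} _ _ ⟨
  ∑₃ (λ i j k → pointwise (a i j) (a i k) (a j k))
    ≡⟨ ∑₃-cong {m} (λ i j k → triple (a i j) (a i k) (a j k)) ⟩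
  ∑₃ {m} (λ i j k → 1 + cherryCount (a i j) (a i k) (a j k))
    ≡⟨ ∑₃-distrib-+ {m} _ _ ⟩
  ∑₃ {m} (λ _ _ _ → 1) + ∑-triples cherryCount a ∎
  where
  pointwise : Bool → Bool → Bool → ℕ
  pointwise x y z = noEdge x y z + edgeCount x y z + allEdges x y z
  triple : ∀ x y z → pointwise x y z ≡ 1 + cherryCount x y z
  triple false false false = refl
  triple false false true = refl
  triple false true false = refl
  triple false true true = refl
  triple true false false = refl
  triple true false true = refl
  triple true true false = refl
  triple true true true = refl

module _ {m} (G H : Adj m) (same : SameIndepPoly G H) where

  sameIndepPoly⇒edges : edges G ≡ edges H
  sameIndepPoly⇒edges = +-cancelˡ-≡ (edges (∁ G)) (edges G) (edges H) (begin
    edges (∁ G) + edges G ≡⟨ edges-∁ G ⟩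
    ∑₂ {m} (λ _ _ → 1)    ≡⟨ edges-∁ H ⟨
    edges (∁ H) + edges H ≡⟨ cong (_+ edges H) (trans (sym (indepCoeff-2 H)) (trans (sym (same 2)) (indepCoeff-2 G)))
                           ⟩
    edges (∁ G) + edges H ∎)

  sameIndepPoly⇒edgeCount : ∑-triples edgeCount G ≡ ∑-triples edgeCount H
  sameIndepPoly⇒edgeCount = +-cancelʳ-≡ (edges G + edges G) _ _ (begin
    ∑-triples edgeCount G + (edges G + edges G) ≡⟨ edges-in-triples G ⟩
    m * edges G                                 ≡⟨ cong (m *_) sameIndepPoly⇒edges ⟩
    m * edges H                                 ≡⟨ edges-in-triples H ⟨
    ∑-triples edgeCount H + (edges H + edges H) ≡⟨ cong (λ e → ∑-triples edgeCount H + (e + e)) sameIndepPoly⇒edges ⟨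
    ∑-triples edgeCount H + (edges G + edges G) ∎)

  sameIndepPoly⇒noEdge : ∑-triples noEdge G ≡ ∑-triples noEdge H
  sameIndepPoly⇒noEdge = trans (sym (indepCoeff-3 G)) (trans (same 3) (indepCoeff-3 H))

  sameIndepPoly⇒cherries-triangles :
    ∑-triples cherryCount G + ∑-triples allEdges H ≡ ∑-triples cherryCount H + ∑-triples allEdges G
  sameIndepPoly⇒cherries-triangles = +-cancelˡ-≡ (∑₃ {m} λ _ _ _ → 1) _ _ (begin
    X + (S₃ G + T₃ H)         ≡⟨ +-assoc X (S₃ G) (T₃ H) ⟨
    X + S₃ G + T₃ H           ≡⟨ cong (_+ T₃ H) (inclusion-exclusion₃ G) ⟨
    N₃ G + E₃ G + T₃ G + T₃ H ≡⟨ cong₂ (λ x y → x + y + T₃ G + T₃ H) sameIndepPoly⇒noEdge sameIndepPoly⇒edgeCount ⟩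
    N₃ H + E₃ H + T₃ G + T₃ H ≡⟨ solve 3 (λ x z w → x :+ z :+ w := x :+ w :+ z) refl (N₃ H + E₃ H) (T₃ G) (T₃ H) ⟩
    N₃ H + E₃ H + T₃ H + T₃ G ≡⟨ cong (_+ T₃ G) (inclusion-exclusion₃ H) ⟩
    X + S₃ H + T₃ G           ≡⟨ +-assoc X (S₃ H) (T₃ G) ⟩
    X + (S₃ H + T₃ G)         ∎)
    where
    X = ∑₃ {m} λ _ _ _ → 1
    N₃ E₃ S₃ T₃ : Adj m → ℕ
    N₃ = ∑-triples noEdge
    E₃ = ∑-triples edgeCount
    S₃ = ∑-triples cherryCount
    T₃ = ∑-triples allEdges

≡ᵇ-sym : ∀ a b → (a ≡ᵇ b) ≡ (b ≡ᵇ a)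
≡ᵇ-sym zero zero = refl
≡ᵇ-sym zero (suc b) = refl
≡ᵇ-sym (suc a) zero = refl
≡ᵇ-sym (suc a) (suc b) = ≡ᵇ-sym a b

≢⇒≡ᵇ-false : ∀ a b → a ≢ b → (a ≡ᵇ b) ≡ false
≢⇒≡ᵇ-false a b a≢b with a ≡ᵇ b in eq
... | false = refl
... | true = ⊥-elim (a≢b (≡ᵇ⇒≡ a b (subst T (sym eq) tt)))

-- cycleSucc n i j computes to cycleSuccℕ n (toℕ i) (toℕ j), so the cycle is studied on ℕ.
cycleSuccℕ : ℕ → ℕ → ℕ → Bool
cycleSuccℕ n a b = (suc a ≡ᵇ b) ∨ ((suc a ≡ᵇ n) ∧ (b ≡ᵇ 0))

cycleAdjℕ : ℕ → ℕ → ℕ → Bool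
cycleAdjℕ n a b = cycleSuccℕ n a b ∨ cycleSuccℕ n b a

cycleSuccℕ-spec : ∀ n a b → T (cycleSuccℕ n a b) → suc a ≡ b ⊎ (suc a ≡ n × b ≡ 0)
cycleSuccℕ-spec n a b succ with Equivalence.to T-∨ succ
... | inj₁ next = inj₁ (≡ᵇ⇒≡ _ _ next)
... | inj₂ wrap with Equivalence.to T-∧ wrap
...   | last , first = inj₂ (≡ᵇ⇒≡ _ _ last , ≡ᵇ⇒≡ _ _ first)

cycleSuccℕ-irrefl : ∀ n a → 2 ≤ n → cycleSuccℕ n a a ≡ false
cycleSuccℕ-irrefl zero zero _ = refl
cycleSuccℕ-irrefl (suc zero) zero (s≤s ())
cycleSuccℕ-irrefl (suc (suc n)) zero _ = refl
cycleSuccℕ-irrefl n (suc a) _ = cong₂ _∨_ (≢⇒≡ᵇ-false (suc (suc a)) (suc a) 1+n≢n) (∧-zeroʳ (suc (suc a) ≡ᵇ n))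

cycleAdj-simple : ∀ n → 2 ≤ n → IsSimpleGraph (cycleAdj n)
cycleAdj-simple n 2≤n = record
  { sym = λ i j → ∨-comm (cycleSucc n i j) (cycleSucc n j i)
  ; irrefl = λ i → cong (λ b → b ∨ b) (cycleSuccℕ-irrefl n (toℕ i) 2≤n)
  }

successors-cycle : ∀ n a → a < n → ∑[ u < n ] ⟦ cycleSuccℕ n a (toℕ u) ⟧ ≡ 1
successors-cycle n a a<n with m≤n⇒m<n∨m≡n a<n
... | inj₁ 1+a<n = trans (sum-cong-≗ {n} λ u → cong ⟦_⟧ (trans
        (cong (λ x → (suc a ≡ᵇ toℕ u) ∨ (x ∧ (toℕ u ≡ᵇ 0))) (≢⇒≡ᵇ-false (suc a) n (<⇒≢ 1+a<n)))
        (∨-identityʳ _)))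
      (sum-≡ᵇ (suc a) 1+a<n)
... | inj₂ refl = trans (sum-cong-≗ {suc a} λ u → cong ⟦_⟧ (trans
        (cong₂ (λ x y → x ∨ (y ∧ (toℕ u ≡ᵇ 0)))
               (≢⇒≡ᵇ-false (suc a) (toℕ u) (λ e → <-irrefl (sym e) (toℕ<n u))) (≡ᵇ-refl a))
        (≡ᵇ-sym (toℕ u) 0)))
      (sum-≡ᵇ {suc a} 0 (s≤s z≤n))
  where
  ≡ᵇ-refl : ∀ a → (a ≡ᵇ a) ≡ true
  ≡ᵇ-refl zero = refl
  ≡ᵇ-refl (suc a) = ≡ᵇ-refl a

predecessors-cycle : ∀ n b → b < n → ∑[ u < n ] ⟦ cycleSuccℕ n (toℕ u) b ⟧ ≡ 1
predecessors-cycle (suc n) zero _ =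
  trans (sum-cong-≗ {suc n} λ u → cong ⟦_⟧ (trans (∧-identityʳ (toℕ u ≡ᵇ n)) (≡ᵇ-sym (toℕ u) n)))
        (sum-≡ᵇ n ≤-refl)
predecessors-cycle n (suc b) 1+b<n =
  trans (sum-cong-≗ {n} λ u → cong ⟦_⟧ (trans (cong ((toℕ u ≡ᵇ b) ∨_) (∧-zeroʳ (suc (toℕ u) ≡ᵇ n)))
                                         (trans (∨-identityʳ _) (≡ᵇ-sym (toℕ u) b))))
        (sum-≡ᵇ b (<-trans (n<1+n b) 1+b<n))

cycleSuccℕ-asym : ∀ n a b → 3 ≤ n → T (cycleSuccℕ n a b) → ¬ T (cycleSuccℕ n b a)
cycleSuccℕ-asym n a b 3≤n ab ba with cycleSuccℕ-spec n a b ab | cycleSuccℕ-spec n b a ba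
... | inj₁ refl | inj₁ 2+a≡a = m+1+n≢n 1 2+a≡a
... | inj₁ refl | inj₂ (refl , refl) with 3≤n
...   | s≤s (s≤s ())
cycleSuccℕ-asym n a b 3≤n ab ba | inj₂ (refl , refl) | inj₁ refl with 3≤n
...   | s≤s (s≤s ())
cycleSuccℕ-asym n a b 3≤n ab ba | inj₂ (refl , refl) | inj₂ (refl , refl) with 3≤n
...   | s≤s ()

deg-cycle : ∀ n → 3 ≤ n → ∀ v → deg (cycleAdj n) v ≡ 2
deg-cycle n 3≤n v = begin
  ∑[ u < n ] ⟦ cycleSuccℕ n (toℕ v) (toℕ u) ∨ cycleSuccℕ n (toℕ u) (toℕ v) ⟧
    ≡⟨ sum-cong-≗ {n} (λ u → ⟦∨⟧-disjoint _ _ λ (vu , uv) → cycleSuccℕ-asym n (toℕ v) (toℕ u) 3≤n vu uv) ⟩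
  ∑[ u < n ] (⟦ cycleSuccℕ n (toℕ v) (toℕ u) ⟧ + ⟦ cycleSuccℕ n (toℕ u) (toℕ v) ⟧)
    ≡⟨ ∑-distrib-+ {n} (λ u → ⟦ cycleSuccℕ n (toℕ v) (toℕ u) ⟧) _ ⟩
  ∑[ u < n ] ⟦ cycleSuccℕ n (toℕ v) (toℕ u) ⟧ + ∑[ u < n ] ⟦ cycleSuccℕ n (toℕ u) (toℕ v) ⟧
    ≡⟨ cong₂ _+_ (successors-cycle n (toℕ v) (toℕ<n v)) (predecessors-cycle n (toℕ v) (toℕ<n v)) ⟩
  2 ∎

cycleAdjℕ-ordered : ∀ n a b → a < b → T (cycleAdjℕ n a b) → b ≡ suc a ⊎ (a ≡ 0 × suc b ≡ n)
cycleAdjℕ-ordered n a b a<b adj with Equivalence.to T-∨ adj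
... | inj₁ ab with cycleSuccℕ-spec n a b ab
...   | inj₁ 1+a≡b = inj₁ (sym 1+a≡b)
...   | inj₂ (_ , refl) with a<b
...     | ()
cycleAdjℕ-ordered n a b a<b adj | inj₂ ba with cycleSuccℕ-spec n b a ba
...   | inj₁ refl = ⊥-elim (<-asym a<b (n<1+n b))
...   | inj₂ (1+b≡n , refl) = inj₂ (refl , 1+b≡n)

-- The edge bc forces c = b + 1; then ac forces a = 0 and c = n − 1, and ab forces either
-- b = 1, i.e. n = 3, or b = n − 1 = c.
cycleAdjℕ-triangle-free : ∀ n a b c → 4 ≤ n → a < b → b < c → c < n →
  T (cycleAdjℕ n a b) → T (cycleAdjℕ n a c) → T (cycleAdjℕ n b c) → ⊥
cycleAdjℕ-triangle-free n a b c 4≤n a<b b<c c<n ab ac bc with cycleAdjℕ-ordered n b c b<c bc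
... | inj₂ (refl , _) with a<b
...   | ()
cycleAdjℕ-triangle-free n a b c 4≤n a<b b<c c<n ab ac bc | inj₁ refl with cycleAdjℕ-ordered n a (suc b) (<-trans a<b b<c) ac
...   | inj₁ 2+b≡1+a = <-irrefl (suc-injective (sym 2+b≡1+a)) a<b
...   | inj₂ (refl , refl) with cycleAdjℕ-ordered (suc (suc b)) 0 b a<b ab
...     | inj₁ refl with 4≤n
...       | s≤s (s≤s (s≤s ()))
cycleAdjℕ-triangle-free n a b c 4≤n a<b b<c c<n ab ac bc | inj₁ refl | inj₂ (refl , refl) | inj₂ (_ , 1+b≡2+b) =
  1+n≢n (sym 1+b≡2+b)

cycle-triangle-free : ∀ n → 4 ≤ n → ∑-triples allEdges (cycleAdj n) ≡ 0
cycle-triangle-free n 4≤n = ∑₃-vanishing _ λ i j k i<j j<k → ⟦⟧≡0 λ all →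
  let ij , ik∧jk = Equivalence.to T-∧ all
      ik , jk = Equivalence.to T-∧ ik∧jk
  in cycleAdjℕ-triangle-free n (toℕ i) (toℕ j) (toℕ k) 4≤n i<j j<k (toℕ<n k) ij ik jk

module _ {m} {a : Adj m} (simple : IsSimpleGraph a) where
  open IsSimpleGraph simple using () renaming (irrefl to adj-irrefl)

  degree≡deg : ∀ v → degree a v ≡ deg a v
  degree≡deg v = trans (countB-allFin {m} _) (sum-cong-≗ {m} drop-self)
    where
    drop-self : ∀ u → ⟦ not (toℕ u ≡ᵇ toℕ v) ∧ a v u ⟧ ≡ ⟦ a v u ⟧
    drop-self u with toℕ u ≡ᵇ toℕ v in u≡ᵇv
    ... | false = refl
    ... | true = cong ⟦_⟧ (sym (trans (cong (a v) u≡v) (adj-irrefl v)))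
      where u≡v = toℕ-injective (≡ᵇ⇒≡ _ _ (subst T (sym u≡ᵇv) tt))

  deg<m : ∀ v → deg a v < m
  deg<m v = sum-indicator-< (a v) v (adj-irrefl v)

  degCount≡sum : ∀ i → degCount a i ≡ ∑[ v < m ] ⟦ deg a v ≡ᵇ i ⟧
  degCount≡sum i = trans (countB-allFin {m} _) (sum-cong-≗ {m} λ v → cong (λ d → ⟦ d ≡ᵇ i ⟧) (degree≡deg v))

  sum-degCount : ∀ (f : ℕ → ℕ) → ∑[ i < m ] (f (toℕ i) * degCount a (toℕ i)) ≡ ∑[ v < m ] f (deg a v)
  sum-degCount f = begin
    ∑[ i < m ] (f (toℕ i) * degCount a (toℕ i))
      ≡⟨ sum-cong-≗ {m} (λ i → cong (f (toℕ i) *_) (degCount≡sum (toℕ i))) ⟩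
    ∑[ i < m ] (f (toℕ i) * ∑[ v < m ] ⟦ deg a v ≡ᵇ toℕ i ⟧)
      ≡⟨ sum-cong-≗ {m} (λ i → *-distribˡ-sum {m} (f (toℕ i)) _) ⟩
    ∑[ i < m ] ∑[ v < m ] (f (toℕ i) * ⟦ deg a v ≡ᵇ toℕ i ⟧)
      ≡⟨ ∑-comm {m} {m} (λ i v → f (toℕ i) * ⟦ deg a v ≡ᵇ toℕ i ⟧) ⟩
    ∑[ v < m ] ∑[ i < m ] (f (toℕ i) * ⟦ deg a v ≡ᵇ toℕ i ⟧)
      ≡⟨ sum-cong-≗ {m} (λ v → sum-pick f (deg a v) (deg<m v)) ⟩
    ∑[ v < m ] f (deg a v) ∎

  sum-degCount-1 : ∑[ i < m ] degCount a (toℕ i) ≡ m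
  sum-degCount-1 = begin
    ∑[ i < m ] degCount a (toℕ i)       ≡⟨ sum-cong-≗ {m} (λ i → *-identityˡ (degCount a (toℕ i))) ⟨
    ∑[ i < m ] (1 * degCount a (toℕ i)) ≡⟨ sum-degCount (λ _ → 1) ⟩
    ∑[ v < m ] 1                        ≡⟨ trans (sum-const m 1) (*-identityʳ m) ⟩
    m ∎

sum-applyUpTo : ∀ N (g h : ℕ → ℕ) → List.sum (map g (applyUpTo h N)) ≡ ∑[ k < N ] g (h (toℕ k))
sum-applyUpTo zero g h = refl
sum-applyUpTo (suc N) g h = cong (g (h 0) +_) (sum-applyUpTo N g (λ k → h (suc k)))

sumRange≡sum : ∀ lo n f → sumRange lo n f ≡ ∑[ k < n ∸ lo ] f (lo + toℕ k)
sumRange≡sum lo n f = sum-applyUpTo (n ∸ lo) (λ k → f (lo + k)) (λ k → k)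

sum-drop : ∀ lo n (f : ℕ → ℕ) → (∀ i → i < lo → f i ≡ 0) →
  ∑[ i < n ] f (toℕ i) ≡ ∑[ k < n ∸ lo ] f (lo + toℕ k)
sum-drop zero n f _ = refl
sum-drop (suc lo) zero f _ = refl
sum-drop (suc lo) (suc n) f f≡0 =
  trans (cong (_+ ∑[ i < n ] f (suc (toℕ i))) (f≡0 0 (s≤s z≤n)))
        (sum-drop lo n (λ i → f (suc i)) (λ i i<lo → f≡0 (suc i) (s≤s i<lo)))

notOneOrTwo : ℕ → ℕ
notOneOrTwo 1 = 0
notOneOrTwo 2 = 0
notOneOrTwo _ = 1

notOneOrTwo-bound : ∀ d → notOneOrTwo d + d ≤ d C 2 + 1
notOneOrTwo-bound 0 = ≤-refl
notOneOrTwo-bound 1 = ≤-refl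
notOneOrTwo-bound 2 = ≤-refl
notOneOrTwo-bound (suc (suc (suc k))) =
  subst₂ _≤_ (solve 1 (λ k → con 2 :+ k :+ con 1 :+ con 1 := con 4 :+ k) refl k)
             (cong (_+ 1) (sym ([1+n]C2≡n+nC2 (2 + k))))
             (+-monoˡ-≤ 1 (+-monoʳ-≤ (2 + k) 1≤[2+k]C2))
  where
  1≤[2+k]C2 : 1 ≤ (2 + k) C 2
  1≤[2+k]C2 = subst (1 ≤_) (sym ([1+n]C2≡n+nC2 (suc k))) (s≤s z≤n)

sum-notOneOrTwo : ∀ n (g : ℕ → ℕ) →
  ∑[ i < suc n ] (notOneOrTwo (toℕ i) * g (toℕ i)) ≡ g 0 + sumRange 3 (suc n) g
sum-notOneOrTwo n g = cong₂ _+_ (+-identityʳ (g 0)) (begin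
  ∑[ i < n ] (notOneOrTwo (suc (toℕ i)) * g (suc (toℕ i)))
    ≡⟨ sum-drop 2 n (λ i → notOneOrTwo (suc i) * g (suc i))
                    (λ { 0 _ → refl ; 1 _ → refl ; (suc (suc _)) (s≤s (s≤s ())) }) ⟩
  ∑[ k < n ∸ 2 ] (1 * g (3 + toℕ k))
    ≡⟨ sum-cong-≗ {n ∸ 2} (λ k → *-identityˡ (g (3 + toℕ k))) ⟩
  ∑[ k < n ∸ 2 ] g (3 + toℕ k)
    ≡⟨ sumRange≡sum 3 (suc n) g ⟨
  sumRange 3 (suc n) g ∎)

module _ {n} (4≤n : 4 ≤ n) {G : Adj n} (simple : IsSimpleGraph G) (same : SameIndepPoly G (cycleAdj n)) where
  private
    3≤n : 3 ≤ n
    3≤n = ≤-trans (n≤1+n 3) 4≤n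

    cycle-simple : IsSimpleGraph (cycleAdj n)
    cycle-simple = cycleAdj-simple n (≤-trans (n≤1+n 2) 3≤n)

    cycle-cherries : ∑-triples cherryCount (cycleAdj n) ≡ n
    cycle-cherries = begin
      ∑-triples cherryCount (cycleAdj n)    ≡⟨ cherries-in-triples (cycleAdj n) cycle-simple ⟩
      ∑[ v < n ] (deg (cycleAdj n) v C 2)   ≡⟨ sum-cong-≗ {n} (λ v → cong (_C 2) (deg-cycle n 3≤n v)) ⟩
      ∑[ v < n ] 1                          ≡⟨ trans (sum-const n 1) (*-identityʳ n) ⟩
      n ∎

  degree-sum : ∑[ v < n ] deg G v ≡ 2 * n
  degree-sum = begin
    ∑[ v < n ] deg G v                      ≡⟨ handshake G simple ⟩
    edges G + edges G                       ≡⟨ cong (λ e → e + e) (sameIndepPoly⇒edges G (cycleAdj n) same) ⟩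
    edges (cycleAdj n) + edges (cycleAdj n) ≡⟨ handshake (cycleAdj n) cycle-simple ⟨
    ∑[ v < n ] deg (cycleAdj n) v           ≡⟨ sum-cong-≗ {n} (deg-cycle n 3≤n) ⟩
    ∑[ v < n ] 2                            ≡⟨ trans (sum-const n 2) (*-comm n 2) ⟩
    2 * n                                   ∎

  degree-C2-sum : ∑[ v < n ] (deg G v C 2) ≡ n + triangles G
  degree-C2-sum = begin
    ∑[ v < n ] (deg G v C 2)
      ≡⟨ cherries-in-triples G simple ⟨
    ∑-triples cherryCount G
      ≡⟨ trans (cong (∑-triples cherryCount G +_) (cycle-triangle-free n 4≤n)) (+-identityʳ _) ⟨
    ∑-triples cherryCount G + ∑-triples allEdges (cycleAdj n)
      ≡⟨ sameIndepPoly⇒cherries-triangles G (cycleAdj n) same ⟩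
    ∑-triples cherryCount (cycleAdj n) + ∑-triples allEdges G
      ≡⟨ cong₂ _+_ cycle-cherries (sym (triangles≡∑-triples G)) ⟩
    n + triangles G ∎

  notOneOrTwo-sum : ∑[ v < n ] notOneOrTwo (deg G v) ≤ triangles G
  notOneOrTwo-sum = +-cancelʳ-≤ (2 * n) _ _ (subst₂ _≤_ lhs rhs (sum-mono-≤ {n} λ v → notOneOrTwo-bound (deg G v)))
    where
    W = ∑[ v < n ] notOneOrTwo (deg G v)

    lhs : ∑[ v < n ] (notOneOrTwo (deg G v) + deg G v) ≡ W + 2 * n
    lhs = trans (∑-distrib-+ {n} (λ v → notOneOrTwo (deg G v)) (deg G)) (cong (W +_) degree-sum)

    rhs : ∑[ v < n ] (deg G v C 2 + 1) ≡ triangles G + 2 * n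
    rhs = begin
      ∑[ v < n ] (deg G v C 2 + 1)            ≡⟨ ∑-distrib-+ {n} (λ v → deg G v C 2) (λ _ → 1) ⟩
      ∑[ v < n ] (deg G v C 2) + ∑[ v < n ] 1 ≡⟨ cong₂ _+_ degree-C2-sum (trans (sum-const n 1) (*-identityʳ n)) ⟩
      n + triangles G + n                     ≡⟨ solve 2 (λ n t → n :+ t :+ n := t :+ con 2 :* n) refl n (triangles G) ⟩
      triangles G + 2 * n                     ∎

lemma9 : (n : ℕ) → n ≥ 4 → (m : ℕ) → (G : Adj m) → IsSimpleGraph G →
    SameIndepPoly G (cycleAdj n) →
    (sumRange 0 n (degCount G) ≡ n)
    × (sumRange 1 n (λ i → i * degCount G i) ≡ 2 * n)
    × (sumRange 2 n (λ i → (i C 2) * degCount G i) ≡ n + triangles G)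
    × (degCount G 0 + sumRange 3 n (degCount G) ≤ triangles G)
lemma9 n 4≤n m G simple same with trans (sym (indepCoeff-1 G)) (trans (same 1) (indepCoeff-1 (cycleAdj n)))
lemma9 (suc n′) 4≤n _ G simple same | refl =
    trans (sumRange≡sum 0 n (degCount G)) (sum-degCount-1 simple)
  , trans (weighted 1 (λ i → i) λ { 0 _ → refl ; (suc _) (s≤s ()) }) (degree-sum 4≤n simple same)
  , trans (weighted 2 (_C 2) λ { 0 _ → refl ; 1 _ → refl ; (suc (suc _)) (s≤s (s≤s ())) })
          (degree-C2-sum 4≤n simple same)
  , subst (_≤ triangles G) (trans (sym (sum-degCount simple notOneOrTwo)) (sum-notOneOrTwo n′ (degCount G)))
      (notOneOrTwo-sum 4≤n simple same)
  where
  n = suc n′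
  weighted : ∀ lo (f : ℕ → ℕ) → (∀ i → i < lo → f i * degCount G i ≡ 0) →
    sumRange lo n (λ i → f i * degCount G i) ≡ ∑[ v < n ] f (deg G v)
  weighted lo f vanish = trans (sumRange≡sum lo n (λ i → f i * degCount G i))
    (trans (sym (sum-drop lo n (λ i → f i * degCount G i) vanish)) (sum-degCount simple f))
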